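{- Let $\underline{\varepsilon}$ and $\underline{\varepsilon}'$ be two nonempty finite words over the alphabet $\{+,-\}$ (possibly of different lengths) with $\underline{\varepsilon}\neq\underline{\varepsilon}'$. Then $\mathcal{G}^{(+,\underline{\varepsilon})}\cap\mathcal{G}^{(+,\underline{\varepsilon}')}=\emptyset$, where $(+,\underline{\varepsilon})$ denotes the word obtained by putting the letter $+$ in front of $\underline{\varepsilon}$.
   Context: An ordered forest of degree $n\ge 0$ is a planar rooted forest $F$ with $n$ vertices (a left-to-right sequence of rooted trees, the children of each vertex being linearly ordered from left to right), together with a bijection from its vertex set to $\{1,\dots,n\}$ (the labels); edges are oriented towards the roots. The empty forest is denoted $1$; an ordered tree is an ordered forest with exactly one connected component; $\bullet_1$ denotes the one-vertex tree. Two ordered forests are equal when there is a label-preserving isomorphism of planar forests. For $n\ge1$ and a word $\underline\varepsilon=(\varepsilon_1,\dots,\varepsilon_n)\in\{+,-\}^n$, a set $\mathcal G^{(\underline\varepsilon)}$ of ordered forests of degree $n$ is defined recursively. $\mathcal G^{(\varepsilon_1)}=\{\bullet_1\}$. For $n\ge2$, let $F'$ range over $\mathcal G^{(\varepsilon_1,\dots,\varepsilon_{n-1})}$ and let $T_1,\dots,T_m$ ($m\ge1$) be the trees of $F'$ from left to right; in each operation below every vertex of $F'$ keeps its label and one new vertex, labelled $n$, is added. If $\varepsilon_n=-$, $\mathcal G^{(\underline\varepsilon)}$ consists of the trees obtained from such $F'$ by adding a new root whose children are the roots of $T_1,\dots,T_m$ in this order. If $\varepsilon_n=+$, $\mathcal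 G^{(\underline\varepsilon)}$ consists of the forests obtained from such $F'$ either (a) by adding the new vertex as a new one-vertex tree at the right end of the forest, or (b) for some $1\le i\le m$, by attaching the new vertex as the rightmost child of the root of $T_i$ and moving $T_{i+1},\dots,T_m$ so that, in this order, their roots become the children of the new vertex (the trees $T_1,\dots,T_{i-1}$ remain unchanged on the left). -}

module Defs where

open import Data.Nat using (ℕ; suc)
open import Data.List using (List; []; _∷_; _++_; [_]; _∷ʳ_; length; reverse)

data Sign : Set where
  plus minus : Sign

-- Structural (propositional) equality of these
-- terms is exactly "label-preserving isomorphism of planar forests".
data Tree : Set where
  node : ℕ → List Tree → Tree

Forest : Set
Forest = List Tree

-- GRev r F : F belongs to 𝒢 of the word (reverse r), i.e. r lists the letters
-- of the word from the LAST letter to the first.  The new vertex added at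
-- step n (word of length n) has label n.
data GRev : List Sign → Forest → Set where
  base  : ∀ s → GRev (s ∷ []) [ node 1 [] ]
  grow- : ∀ {r F} → GRev r F →
          GRev (minus ∷ r) [ node (suc (length r)) F ]
  growNew : ∀ {r F} → GRev r F →
          GRev (plus ∷ r) (F ∷ʳ node (suc (length r)) [])
  -- εₙ = + , (b) : F' = pre ++ Tᵢ ∷ post with Tᵢ = node a cs; the new vertex
  -- becomes the rightmost child of the root of Tᵢ, and the trees of post
  -- (T_{i+1},…,Tₘ, in order) become the children of the new vertex.
  growGraft : ∀ {r} pre a cs post → GRev r (pre ++ node a cs ∷ post) →
          GRev (plus ∷ r)
               (pre ++ [ node a (cs ∷ʳ node (suc (length r)) post) ])

𝒢 : List Sign → Forest → Set
𝒢 w F = GRev (reverse w) F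

-- The forest F records, through its largest label n, how the last step of the
-- construction was made: a single tree with root n comes from a minus-step,
-- a rightmost tree that is the leaf n from step (a), and a rightmost tree whose
-- last child is n from step (b).  These shapes are pairwise incompatible (for
-- the first and last one because every label of the predecessor forest is
-- below n), and undoing the step recovers the predecessor forest.  Hence F
-- determines its word except for the first letter, which 𝒢^(+) and 𝒢^(-)
-- cannot tell apart; prefixing + removes that ambiguity.
module Submission where

open import Defs
open import Data.Empty using (⊥; ⊥-elim)
open import Data.List using (List; []; _∷_; _++_; [_]; _∷ʳ_; length; reverse)
open import Data.List.Properties
  using (++-assoc; ∷-injective; ∷ʳ-injective; reverse-injective; unfold-reverse)
open import Data.List.Relation.Unary.All using (All; []; _∷_)
import Data.List.Relation.Unary.All as All
open import Data.List.Relation.Unary.All.Properties using (++⁺; ++⁻)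
open import Data.Nat using (ℕ; suc; _≤_)
open import Data.Nat.Properties using (≤-refl; m≤n⇒m≤1+n; <-asym)
open import Data.Product using (_×_; _,_; proj₁; proj₂)
open import Relation.Binary.PropositionalEquality
  using (_≡_; _≢_; refl; sym; trans; cong; subst; subst₂)

private
  variable
    r r′ : List Sign
    F F′ : Forest

node-injective : ∀ {a b cs ds} → node a cs ≡ node b ds → a ≡ b × cs ≡ ds
node-injective refl = refl , refl

∷ʳ≢[] : ∀ {A : Set} (xs : List A) {x} → xs ∷ʳ x ≢ []
∷ʳ≢[] []      ()
∷ʳ≢[] (_ ∷ _) ()

GRev-nonempty : GRev r F → F ≢ []
GRev-nonempty (base _)                  ()
GRev-nonempty (grow- _)                 ()
GRev-nonempty (growNew {F = G} _)       = ∷ʳ≢[] G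
GRev-nonempty (growGraft pre _ _ _ _)   = ∷ʳ≢[] pre

labels : Forest → List ℕ
labels []                = []
labels (node a cs ∷ ts)  = a ∷ labels cs ++ labels ts

labels-++ : ∀ xs ys → labels (xs ++ ys) ≡ labels xs ++ labels ys
labels-++ []               ys = refl
labels-++ (node a cs ∷ xs) ys =
  trans (cong (λ l → a ∷ labels cs ++ l) (labels-++ xs ys))
        (cong (a ∷_) (sym (++-assoc (labels cs) (labels xs) (labels ys))))

module _ {P : ℕ → Set} where

  All-labels-++⁺ : ∀ xs {ys} → All P (labels xs) → All P (labels ys) →
                   All P (labels (xs ++ ys))
  All-labels-++⁺ xs {ys} p q = subst (All P) (sym (labels-++ xs ys)) (++⁺ p q)

  All-labels-++⁻ : ∀ xs {ys} → All P (labels (xs ++ ys)) →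
                   All P (labels xs) × All P (labels ys)
  All-labels-++⁻ xs {ys} p = ++⁻ (labels xs) (subst (All P) (labels-++ xs ys) p)

GRev-labels-≤ : GRev r F → All (_≤ length r) (labels F)
GRev-labels-≤ (base _)  = ≤-refl ∷ []
GRev-labels-≤ (grow- d) = ≤-refl ∷ ++⁺ (All.map m≤n⇒m≤1+n (GRev-labels-≤ d)) []
GRev-labels-≤ (growNew {F = F} d) =
  All-labels-++⁺ F (All.map m≤n⇒m≤1+n (GRev-labels-≤ d)) (≤-refl ∷ [])
GRev-labels-≤ (growGraft pre a cs post d)
  with pre≤ , a≤ ∷ cs++post≤ ← All-labels-++⁻ pre (All.map m≤n⇒m≤1+n (GRev-labels-≤ d))
  with cs≤ , post≤ ← ++⁻ (labels cs) cs++post≤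
  = All-labels-++⁺ pre pre≤
      (a≤ ∷ ++⁺ (All-labels-++⁺ cs cs≤ (≤-refl ∷ ++⁺ post≤ [])) [])

single≢∷ʳleaf : ∀ {n m} G xs → G ≢ [] → [ node n G ] ≢ xs ∷ʳ node m []
single≢∷ʳleaf G xs G≢[] eq with refl , eq′ ← ∷ʳ-injective [] xs eq =
  G≢[] (proj₂ (node-injective eq′))

∷ʳleaf≢∷ʳgraft : ∀ xs pre {n a cs t} → xs ∷ʳ node n [] ≢ pre ∷ʳ node a (cs ∷ʳ t)
∷ʳleaf≢∷ʳgraft xs pre {cs = cs} eq =
  ∷ʳ≢[] cs (sym (proj₂ (node-injective (proj₂ (∷ʳ-injective xs pre eq)))))

-- The root of a minus-step is the largest label, while the root of a graft
-- lies below the grafted vertex.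
grow-≢growGraft : ∀ {G} pre a cs post → GRev r G → GRev r′ (pre ++ node a cs ∷ post) →
  [ node (suc (length r)) G ] ≢ pre ∷ʳ node a (cs ∷ʳ node (suc (length r′)) post)
grow-≢growGraft pre a cs post d d′ eq
  with refl , eq′ ← ∷ʳ-injective [] pre eq
  with refl , refl ← node-injective eq′
  with a≤ ∷ _ ← GRev-labels-≤ d′
  with m≤ ∷ _ ← proj₂ (All-labels-++⁻ cs (GRev-labels-≤ d))
  = <-asym a≤ m≤

-- Applied to reversed words, so the letter left free is the first letter of the word.
data EqualUpToLast : List Sign → List Sign → Set where
  last : ∀ s s′ → EqualUpToLast [ s ] [ s′ ]
  _∷_  : ∀ x → EqualUpToLast r r′ → EqualUpToLast (x ∷ r) (x ∷ r′)

GRev-determines : GRev r F → GRev r′ F′ → F ≡ F′ → EqualUpToLast r r′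
GRev-determines (base s) (base s′) _ = last s s′
GRev-determines (base _) (grow- d′) eq =
  ⊥-elim (single≢∷ʳleaf _ [] (GRev-nonempty d′) (sym eq))
GRev-determines (base _) (growNew {F = G} d′) eq =
  ⊥-elim (GRev-nonempty d′ (sym (proj₁ (∷ʳ-injective [] G eq))))
GRev-determines (base _) (growGraft pre _ _ _ _) eq =
  ⊥-elim (∷ʳleaf≢∷ʳgraft [] pre eq)
GRev-determines (grow- d) (base _) eq =
  ⊥-elim (single≢∷ʳleaf _ [] (GRev-nonempty d) eq)
GRev-determines (grow- d) (grow- d′) eq =
  minus ∷ GRev-determines d d′ (proj₂ (node-injective (proj₁ (∷-injective eq))))
GRev-determines (grow- d) (growNew {F = G} _) eq =
  ⊥-elim (single≢∷ʳleaf _ G (GRev-nonempty d) eq)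
GRev-determines (grow- d) (growGraft pre a cs post d′) eq =
  ⊥-elim (grow-≢growGraft pre a cs post d d′ eq)
GRev-determines (growNew {F = G} d) (base _) eq =
  ⊥-elim (GRev-nonempty d (proj₁ (∷ʳ-injective G [] eq)))
GRev-determines (growNew {F = G} _) (grow- d′) eq =
  ⊥-elim (single≢∷ʳleaf _ G (GRev-nonempty d′) (sym eq))
GRev-determines (growNew {F = G} d) (growNew {F = G′} d′) eq =
  plus ∷ GRev-determines d d′ (proj₁ (∷ʳ-injective G G′ eq))
GRev-determines (growNew {F = G} _) (growGraft pre _ _ _ _) eq =
  ⊥-elim (∷ʳleaf≢∷ʳgraft G pre eq)
GRev-determines (growGraft pre _ _ _ _) (base _) eq =
  ⊥-elim (∷ʳleaf≢∷ʳgraft [] pre (sym eq))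
GRev-determines (growGraft pre a cs post d) (grow- d′) eq =
  ⊥-elim (grow-≢growGraft pre a cs post d′ d (sym eq))
GRev-determines (growGraft pre _ _ _ _) (growNew {F = G} _) eq =
  ⊥-elim (∷ʳleaf≢∷ʳgraft G pre (sym eq))
GRev-determines (growGraft pre a cs post d) (growGraft pre′ a′ cs′ post′ d′) eq
  with refl , eq₁ ← ∷ʳ-injective pre pre′ eq
  with refl , eq₂ ← node-injective eq₁
  with refl , eq₃ ← ∷ʳ-injective cs cs′ eq₂
  with _ , refl ← node-injective eq₃
  = plus ∷ GRev-determines d d′ refl

EqualUpToLast-∷ʳ : ∀ xs ys {s s′} → EqualUpToLast (xs ∷ʳ s) (ys ∷ʳ s′) → xs ≡ ys
EqualUpToLast-∷ʳ []       []       _       = refl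
EqualUpToLast-∷ʳ []       (_ ∷ []) (_ ∷ ())
EqualUpToLast-∷ʳ []       (_ ∷ _ ∷ _) (_ ∷ ())
EqualUpToLast-∷ʳ (_ ∷ []) []       (_ ∷ ())
EqualUpToLast-∷ʳ (_ ∷ _ ∷ _) []    (_ ∷ ())
EqualUpToLast-∷ʳ (x ∷ xs) (x ∷ ys) (x ∷ e) = cong (x ∷_) (EqualUpToLast-∷ʳ xs ys e)

mainTheorem1 : (ε ε′ : List Sign) → ε ≢ [] → ε′ ≢ [] → ε ≢ ε′ →
    (F : Forest) → 𝒢 (plus ∷ ε) F → 𝒢 (plus ∷ ε′) F → ⊥
mainTheorem1 ε ε′ _ _ ε≢ε′ F d d′ = ε≢ε′ (reverse-injective reverse-ε≡reverse-ε′)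
  where
  reverse-ε≡reverse-ε′ : reverse ε ≡ reverse ε′
  reverse-ε≡reverse-ε′ = EqualUpToLast-∷ʳ (reverse ε) (reverse ε′)
    (subst₂ EqualUpToLast (unfold-reverse plus ε) (unfold-reverse plus ε′)
      (GRev-determines d d′ refl))
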